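{- For all natural numbers $k$ and $d$, there exists a graph $G(k,d)$ of minimum degree at least $d$ such that every spanning tree of $G(k,d)$ contains, for every $i\in\{1,\ldots,k\}$, a vertex of degree $i$ (degree taken in the spanning tree).
   Context: All graphs are simple and finite. -}

module Defs where

open import Data.Nat using (ℕ; zero; suc; _+_; _≤_; _≥_)
open import Data.Fin using (Fin)
open import Data.Bool using (Bool; true; false; if_then_else_)
open import Data.List using (List; []; _∷_; length; map; allFin; head; last)
open import Data.Nat.ListAction using (sum)
open import Data.Unit using (⊤)
open import Data.List.Relation.Unary.Unique.Propositional using (Unique)
open import Data.Maybe using (Maybe; just)
open import Data.Product using (Σ; _×_; ∃-syntax)
open import Relation.Binary.PropositionalEquality using (_≡_)
open import Relation.Nullary using (¬_)

record Graph : Set where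
  field
    n     : ℕ
    adj   : Fin n → Fin n → Bool
    sym   : ∀ u v → adj u v ≡ adj v u
    irref : ∀ v → adj v v ≡ false
open Graph public

Rel : ℕ → Set
Rel n = Fin n → Fin n → Bool

deg : ∀ {n} → Rel n → Fin n → ℕ
deg {n} E v = sum (map (λ w → if E v w then 1 else 0) (allFin n))

IsWalk : ∀ {n} → Rel n → List (Fin n) → Set
IsWalk E []               = ⊤
IsWalk E (x ∷ [])         = ⊤
IsWalk E (x ∷ y ∷ xs)     = (E x y ≡ true) × IsWalk E (y ∷ xs)

Connected : ∀ {n} → Rel n → Set
Connected {n} E = ∀ (u v : Fin n) →
  ∃[ p ] (IsWalk E p × head p ≡ just u × last p ≡ just v)

IsCycle : ∀ {n} → Rel n → List (Fin n) → Set
IsCycle E p = 3 ≤ length p × Unique p × IsWalk E p ×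
  (∀ a b → head p ≡ just a → last p ≡ just b → E b a ≡ true)

Acyclic : ∀ {n} → Rel n → Set
Acyclic E = ∀ p → ¬ IsCycle E p

record SpanningTree (G : Graph) : Set where
  field
    tadj    : Rel (n G)
    tsym    : ∀ u v → tadj u v ≡ tadj v u
    sub     : ∀ u v → tadj u v ≡ true → adj G u v ≡ true
    tconn   : Connected tadj
    tacyc   : Acyclic tadj
open SpanningTree public

MinDegreeAtLeast : Graph → ℕ → Set
MinDegreeAtLeast G d = ∀ v → deg (adj G) v ≥ d

-- G(k, d) is glued from cliques on d + 2 vertices, so its minimum degree is at least d + 1.  For
-- each t < k a core clique carries, at each of its vertices, t + 1 pendant cliques attached by a
-- single edge; one of them also joins the core to a hub clique, and every remaining clique hangs
-- off the hub.  Each attaching edge is the only edge leaving some vertex set, hence lies in every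
-- spanning tree T.  The tuft formed by a core vertex not linked to the hub and its pendants can
-- only be left along a core edge, so T restricted to the core is a forest with an edge; a leaf of
-- it has degree 1 + (t + 1) in T.  Degree 1 is realised by any leaf of T.
module Submission where

open import Defs hiding (sym)
open import Data.Nat using (ℕ; zero; suc; _+_; _*_; _≤_; _<_; z≤n; s≤s; s≤s⁻¹)
open import Data.Nat.Properties using (≤-refl; ≤-trans; ≤-antisym; +-suc; <-irrefl; <-≤-trans; m≤n+m; m<m+n; n≤1+n; ≰⇒>; <⇒≱)
open import Data.Nat.ListAction using (sum)
open import Data.Bool using (true; false; if_then_else_)
open import Data.Bool.Properties using () renaming (_≟_ to _≟ᴮ_)
open import Data.Empty using (⊥-elim)
open import Data.Fin using (Fin; suc; punchIn; toℕ; fromℕ<; inject≤) renaming (_≟_ to _≟ᶠ_; _≤_ to _≤ᶠ_; _<_ to _<ᶠ_)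
open import Data.Fin.Patterns using (0F; 1F)
open import Data.Fin.Properties using (1↔⊤; +↔⊎; *↔×; punchIn-injective; punchInᵢ≢i; _≤?_; _<?_; toℕ<n; toℕ-injective; toℕ-inject≤; toℕ-fromℕ<; inject≤-injective)
open import Data.List using (List; []; _∷_; _++_; [_]; _∷ʳ_; length; map; allFin; filter; head; last)
open import Data.List.Properties using (length-++; length-map; length-tabulate; ++-assoc)
open import Data.List.Membership.Propositional using (_∈_; lose)
open import Data.List.Membership.Propositional.Properties using (∈-∃++; ∈-++⁻; ∈-++⁺ˡ; ∈-++⁺ʳ; ∈-allFin; ∈-filter⁺; ∈-filter⁻; ∈-map⁻; ∈-map⁺)
open import Data.List.Relation.Binary.Subset.Propositional using (_⊆_)
open import Data.List.Relation.Unary.All as All using ([]; _∷_)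
open import Data.List.Relation.Unary.All.Properties using (++⁻ˡ; ¬Any⇒All¬)
open import Data.List.Relation.Unary.AllPairs using ([]; _∷_)
open import Data.List.Relation.Unary.Any using (here; there; any?; satisfied)
open import Data.List.Relation.Unary.Unique.Propositional using (Unique)
open import Data.List.Relation.Unary.Unique.Propositional.Properties using (allFin⁺; filter⁺; map⁺)
open import Data.Maybe using (just)
open import Data.Product using (_×_; _,_; proj₁; proj₂; ∃-syntax)
open import Data.Product.Function.NonDependent.Propositional using (_×-↔_)
import Data.Product.Properties as ×
open import Data.Sum using (_⊎_; inj₁; inj₂; swap)
open import Data.Sum.Function.Propositional using (_⊎-↔_)
import Data.Sum.Properties as ⊎
open import Data.Unit using (⊤; tt)
import Data.Unit.Properties as ⊤
open import Function.Bundles using (_↔_; Inverse; mk⇔)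
open import Function.Properties.Inverse using (↔-refl; ↔-trans)
open import Relation.Binary.Construct.Closure.ReflexiveTransitive using (Star; ε; _◅_; _◅◅_; gmap; reverse)
open import Relation.Binary.Definitions using (DecidableEquality)
open import Relation.Binary.PropositionalEquality using (_≡_; _≢_; refl; sym; trans; cong; subst; subst₂)
open import Relation.Nullary using (¬_; Dec; yes; no; does; ¬?; _×-dec_; _⊎-dec_; contradiction)
open import Relation.Nullary.Decidable using (map′; dec-true; dec-false; does-⇔)
open import Relation.Unary using (Decidable)

unique-⊆⇒length≤ : {A : Set} {xs ys : List A} → Unique xs → xs ⊆ ys → length xs ≤ length ys
unique-⊆⇒length≤ {xs = []} _ _ = z≤n
unique-⊆⇒length≤ {xs = x ∷ xs} (x∉xs ∷ xs!) xs⊆ys with ∈-∃++ (xs⊆ys (here refl))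
... | A , B , refl = subst (length (x ∷ xs) ≤_) (sym length-A++x∷B)
                        (s≤s (subst (length xs ≤_) (length-++ A) (unique-⊆⇒length≤ xs! xs⊆A++B)))
  where
  length-A++x∷B : length (A ++ x ∷ B) ≡ suc (length A + length B)
  length-A++x∷B = trans (length-++ A) (+-suc (length A) (length B))
  xs⊆A++B : xs ⊆ A ++ B
  xs⊆A++B z∈xs with ∈-++⁻ A (xs⊆ys (there z∈xs))
  ... | inj₁ z∈A = ∈-++⁺ˡ z∈A
  ... | inj₂ (here refl) = ⊥-elim (All.lookup x∉xs z∈xs refl)
  ... | inj₂ (there z∈B) = ∈-++⁺ʳ A z∈B

unique⇒length≤ : ∀ {n} {xs : List (Fin n)} → Unique xs → length xs ≤ n
unique⇒length≤ {n} {xs} xs! =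
  subst (length xs ≤_) (length-tabulate {n = n} (λ i → i)) (unique-⊆⇒length≤ xs! (λ _ → ∈-allFin _))

adjacent? : ∀ {n} (E : Rel n) v → Decidable (λ w → E v w ≡ true)
adjacent? E v w = E v w ≟ᴮ true

neighbours : ∀ {n} → Rel n → Fin n → List (Fin n)
neighbours {n} E v = filter (adjacent? E v) (allFin n)

deg≡length-neighbours : ∀ {n} (E : Rel n) v → deg E v ≡ length (neighbours E v)
deg≡length-neighbours {n} E v = count (allFin n)
  where
  count : ∀ xs → sum (map (λ w → if E v w then 1 else 0) xs) ≡ length (filter (adjacent? E v) xs)
  count [] = refl
  count (x ∷ xs) with E v x
  ... | true  = cong suc (count xs)
  ... | false = count xs

length≤deg : ∀ {n} (E : Rel n) v {ws : List (Fin n)} → Unique ws →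
  (∀ {w} → w ∈ ws → E v w ≡ true) → length ws ≤ deg E v
length≤deg E v {ws} ws! adj = subst (length ws ≤_) (sym (deg≡length-neighbours E v))
  (unique-⊆⇒length≤ ws! (λ w∈ws → ∈-filter⁺ (adjacent? E v) (∈-allFin _) (adj w∈ws)))

deg≡length : ∀ {n} (E : Rel n) v {ws : List (Fin n)} → Unique ws →
  (∀ {w} → w ∈ ws → E v w ≡ true) → (∀ {w} → E v w ≡ true → w ∈ ws) → deg E v ≡ length ws
deg≡length {n} E v {ws} ws! adj nbr = ≤-antisym
  (subst (_≤ length ws) (sym (deg≡length-neighbours E v))
    (unique-⊆⇒length≤ (filter⁺ (adjacent? E v) (allFin⁺ n))
      (λ w∈N → nbr (proj₂ (∈-filter⁻ (adjacent? E v) {xs = allFin n} w∈N)))))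
  (length≤deg E v ws! adj)

walk-crosses : ∀ {n} (E : Rel n) {P : Fin n → Set} → Decidable P → ∀ {p u v} →
  IsWalk E p → head p ≡ just u → last p ≡ just v → P u → ¬ P v →
  ∃[ a ] ∃[ b ] (E a b ≡ true × P a × ¬ P b)
walk-crosses E {P} P? {x ∷ p} walk refl = from x p walk
  where
  from : ∀ u p {v} → IsWalk E (u ∷ p) → last (u ∷ p) ≡ just v → P u → ¬ P v →
    ∃[ a ] ∃[ b ] (E a b ≡ true × P a × ¬ P b)
  from u [] _ refl Pu ¬Pv = contradiction Pu ¬Pv
  from u (w ∷ p) (Euw , walk) lst Pu ¬Pv with P? w
  ... | yes Pw = from w p walk lst Pw ¬Pv
  ... | no ¬Pw = u , w , Euw , Pu , ¬Pw

connected-crosses : ∀ {n} {E : Rel n} → Connected E → {P : Fin n → Set} → Decidable P →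
  ∀ {u v} → P u → ¬ P v → ∃[ a ] ∃[ b ] (E a b ≡ true × P a × ¬ P b)
connected-crosses {E = E} conn P? {u} {v} with conn u v
... | p , walk , hd , lst = walk-crosses E P? walk hd lst

star⇒walk : ∀ {n} {E : Rel n} {u v} → Star (λ a b → E a b ≡ true) u v →
  ∃[ p ] (IsWalk E p × head p ≡ just u × last p ≡ just v)
star⇒walk {u = u} ε = u ∷ [] , tt , refl , refl
star⇒walk {u = u} (Euw ◅ s) with star⇒walk s
... | w ∷ p , walk , refl , lst = u ∷ w ∷ p , (Euw , walk) , refl , lst

IsWalk-++⁻ˡ : ∀ {n} (E : Rel n) xs {ys} → IsWalk E (xs ++ ys) → IsWalk E xs
IsWalk-++⁻ˡ E []           _           = tt
IsWalk-++⁻ˡ E (x ∷ [])     _           = tt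
IsWalk-++⁻ˡ E (x ∷ y ∷ xs) (Exy , walk) = Exy , IsWalk-++⁻ˡ E (y ∷ xs) walk

Unique-++⁻ˡ : {A : Set} (xs : List A) {ys : List A} → Unique (xs ++ ys) → Unique xs
Unique-++⁻ˡ []       _             = []
Unique-++⁻ˡ (x ∷ xs) (x∉ ∷ xs++ys!) = ++⁻ˡ xs x∉ ∷ Unique-++⁻ˡ xs xs++ys!

last-∷ʳ : {A : Set} (xs : List A) (z : A) → last (xs ∷ʳ z) ≡ just z
last-∷ʳ []           z = refl
last-∷ʳ (x ∷ [])     z = refl
last-∷ʳ (x ∷ y ∷ xs) z = last-∷ʳ (y ∷ xs) z

-- The cycle is the initial segment x y … z of the path, closed by the edge z x.
path-closing⇒cycle : ∀ {n} (E : Rel n) {x y z rest} →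
  Unique (x ∷ y ∷ rest) → IsWalk E (x ∷ y ∷ rest) → z ∈ rest → E z x ≡ true → ∃[ c ] IsCycle E c
path-closing⇒cycle E {x} {y} {z} path! walk z∈rest Ezx with ∈-∃++ z∈rest
... | A , B , refl = c , 3≤length , Unique-++⁻ˡ c (subst Unique c++B path!) ,
                     IsWalk-++⁻ˡ E c (subst (IsWalk E) c++B walk) , closed
  where
  c : List _
  c = (x ∷ y ∷ A) ∷ʳ z
  c++B : x ∷ y ∷ A ++ z ∷ B ≡ c ++ B
  c++B = cong (λ l → x ∷ y ∷ l) (sym (++-assoc A [ z ] B))
  3≤length : 3 ≤ length c
  3≤length = s≤s (s≤s (subst (1 ≤_) (sym (length-++ A)) (m≤n+m 1 (length A))))
  closed : ∀ a b → head c ≡ just a → last c ≡ just b → E b a ≡ true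
  closed a b refl lst with trans (sym (last-∷ʳ (x ∷ y ∷ A) z)) lst
  ... | refl = Ezx

InducedLeaf : ∀ {n} → Rel n → (Fin n → Set) → Fin n → Fin n → Set
InducedLeaf E C x y = C x × C y × E x y ≡ true × (∀ z → C z → E x z ≡ true → z ≡ y)

-- A longest path in the subforest induced by C ends in a leaf: a C-neighbour of its end
-- other than its predecessor would either close a cycle or extend the path.
module _ {n} {E : Rel n} (E-sym : ∀ u v → E u v ≡ E v u) (E-irrefl : ∀ v → E v v ≡ false)
         (acyclic : Acyclic E) {C : Fin n → Set} (C? : Decidable C) where

  open import Data.List.Membership.DecPropositional (_≟ᶠ_ {n}) using (_∈?_)

  private
    extend : (fuel : ℕ) (x y : Fin n) (rest : List (Fin n)) → n < fuel + length (x ∷ y ∷ rest) →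
      Unique (x ∷ y ∷ rest) → IsWalk E (x ∷ y ∷ rest) → C x → C y →
      ∃[ x ] ∃[ y ] InducedLeaf E C x y
    extend zero x y rest n<len path! _ _ _ =
      contradiction (<-≤-trans n<len (unique⇒length≤ path!)) (<-irrefl refl)
    extend (suc fuel) x y rest n<len path! walk Cx Cy
      with any? (λ z → C? z ×-dec E x z ≟ᴮ true ×-dec ¬? (z ≟ᶠ y)) (allFin n)
    ... | no none = x , y , Cx , Cy , proj₁ walk , onlyY
      where
      onlyY : ∀ z → C z → E x z ≡ true → z ≡ y
      onlyY z Cz Exz with z ≟ᶠ y
      ... | yes z≡y = z≡y
      ... | no z≢y = contradiction (lose (∈-allFin z) (Cz , Exz , z≢y)) none
    ... | yes some with satisfied some
    ... | z , Cz , Exz , z≢y with z ∈? (x ∷ y ∷ rest)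
    ... | yes (here refl) = contradiction (trans (sym Exz) (E-irrefl x)) λ ()
    ... | yes (there (here refl)) = contradiction refl z≢y
    ... | yes (there (there z∈rest)) =
      ⊥-elim (acyclic _ (proj₂ (path-closing⇒cycle E path! walk z∈rest (trans (E-sym z x) Exz))))
    ... | no z∉path = extend fuel z x (y ∷ rest) (subst (n <_) (sym (+-suc fuel _)) n<len)
                        (¬Any⇒All¬ _ z∉path ∷ path!) (trans (E-sym z x) Exz , walk) Cz Cx

  acyclic⇒induced-leaf : ∀ {a b} → C a → C b → E a b ≡ true → ∃[ x ] ∃[ y ] InducedLeaf E C x y
  acyclic⇒induced-leaf {a} {b} Ca Cb Eab =
    extend n a b [] (m<m+n n (s≤s z≤n)) ((a≢b ∷ []) ∷ [] ∷ []) (Eab , tt) Ca Cb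
    where
    a≢b : a ≢ b
    a≢b refl = contradiction (trans (sym Eab) (E-irrefl a)) λ ()

tree-irrefl : ∀ {G} (T : SpanningTree G) v → tadj T v v ≡ false
tree-irrefl {G} T v with tadj T v v in vv
... | false = refl
... | true = contradiction (trans (sym (irref G v)) (sub T v v vv)) λ ()

tree-induced-leaf : ∀ {G} (T : SpanningTree G) {C : Fin (n G) → Set} → Decidable C →
  ∀ {a b} → C a → C b → tadj T a b ≡ true → ∃[ x ] ∃[ y ] InducedLeaf (tadj T) C x y
tree-induced-leaf T = acyclic⇒induced-leaf (tsym T) (tree-irrefl T) (tacyc T)

decided : {A : Set} (a? : Dec A) → does a? ≡ true → A
decided (yes a) _ = a

module Construction (k d : ℕ) where

  m : ℕ
  m = suc (suc d)

  Block : Set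
  Block = ⊤ ⊎ (Fin k ⊎ Fin k × Fin m × Fin k)

  pattern hub = inj₁ tt
  pattern core t = inj₂ (inj₁ t)
  pattern pend t j p = inj₂ (inj₂ (t , j , p))

  _≟ᵇ_ : DecidableEquality Block
  _≟ᵇ_ = ⊎.≡-dec ⊤._≟_ (⊎.≡-dec _≟ᶠ_ (×.≡-dec _≟ᶠ_ (×.≡-dec _≟ᶠ_ _≟ᶠ_)))

  V : Set
  V = Block × Fin m

  _≟ⱽ_ : DecidableEquality V
  _≟ⱽ_ = ×.≡-dec _≟ᵇ_ _≟ᶠ_

  N : ℕ
  N = (1 + (k + k * (m * k))) * m

  abstract
    vertex↔ : Fin N ↔ V
    vertex↔ = ↔-trans *↔× (blocks ×-↔ ↔-refl)
      where
      blocks : Fin (1 + (k + k * (m * k))) ↔ Block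
      blocks = ↔-trans +↔⊎ (1↔⊤ ⊎-↔ ↔-trans +↔⊎ (↔-refl ⊎-↔ ↔-trans *↔× (↔-refl ×-↔ *↔×)))

  open Inverse vertex↔ using ()
    renaming (to to vertex; from to index; strictlyInverseˡ to vertex-index; strictlyInverseʳ to index-vertex)

  index-injective : ∀ {x y} → index x ≡ index y → x ≡ y
  index-injective {x} {y} eq = trans (sym (vertex-index x)) (trans (cong vertex eq) (vertex-index y))

  -- The pendant blocks with
  -- t < p only pad the index set Fin k × Fin m × Fin k and hang off the hub.
  data Edge : V → V → Set where
    clique : ∀ b {r r′} → r ≢ r′ → Edge (b , r) (b , r′)
    bridge : ∀ {t p} j → p ≤ᶠ t → Edge (core t , j) (pend t j p , 0F)
    tether : ∀ {t j p} → t <ᶠ p → Edge (pend t j p , 0F) (hub , 0F)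
    link   : ∀ t → Edge (pend t 0F t , 1F) (hub , 0F)

  Adj : V → V → Set
  Adj u v = Edge u v ⊎ Edge v u

  Edge-irrefl : ∀ {v} → ¬ Edge v v
  Edge-irrefl (clique _ r≢r) = r≢r refl

  Edge? : ∀ u v → Dec (Edge u v)
  Edge? (b , r) (b′ , r′) with b ≟ᵇ b′
  ... | yes refl = map′ (clique b) (λ { (clique _ r≢r′) → r≢r′ }) (¬? (r ≟ᶠ r′))
  ... | no b≢b′ = between b b′ b≢b′ r r′
    where
    between : ∀ b b′ → b ≢ b′ → ∀ r r′ → Dec (Edge (b , r) (b′ , r′))
    between (core t) (pend t′ j p) _ r 0F =
      map′ (λ { (refl , refl , p≤t) → bridge r p≤t }) (λ { (bridge _ p≤t) → refl , refl , p≤t })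
           (t ≟ᶠ t′ ×-dec r ≟ᶠ j ×-dec p ≤? t)
    between (core _) (pend _ _ _) _ _ (suc _) = no λ ()
    between (pend t j p) hub _ 0F 0F = map′ tether (λ { (tether t<p) → t<p }) (t <? p)
    between (pend t j p) hub _ 1F 0F =
      map′ (λ { (refl , refl) → link t }) (λ { (link _) → refl , refl }) (j ≟ᶠ 0F ×-dec p ≟ᶠ t)
    between (pend _ _ _) hub _ (suc (suc _)) 0F = no λ ()
    between (pend _ _ _) hub _ _ (suc _) = no λ ()
    between hub hub b≢b′ _ _ = no λ { (clique _ _) → b≢b′ refl }
    between hub (core _) _ _ _ = no λ ()
    between hub (pend _ _ _) _ _ _ = no λ ()
    between (core _) hub _ _ _ = no λ ()
    between (core _) (core _) b≢b′ _ _ = no λ { (clique _ _) → b≢b′ refl }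
    between (pend _ _ _) (core _) _ _ _ = no λ ()
    between (pend _ _ _) (pend _ _ _) b≢b′ _ _ = no λ { (clique _ _) → b≢b′ refl }

  Adj? : ∀ u v → Dec (Adj u v)
  Adj? u v = Edge? u v ⊎-dec Edge? v u

  G : Graph
  G = record
    { n     = N
    ; adj   = λ u v → does (Adj? (vertex u) (vertex v))
    ; sym   = λ u v → does-⇔ (mk⇔ swap swap) (Adj? (vertex u) (vertex v)) (Adj? (vertex v) (vertex u))
    ; irref = λ v → dec-false (Adj? (vertex v) (vertex v))
                      λ { (inj₁ e) → Edge-irrefl e ; (inj₂ e) → Edge-irrefl e }
    }

  adj⇒Adj : ∀ {u v} → adj G u v ≡ true → Adj (vertex u) (vertex v)
  adj⇒Adj {u} {v} = decided (Adj? (vertex u) (vertex v))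

  Adj⇒adj : ∀ {x y} → Adj x y → adj G (index x) (index y) ≡ true
  Adj⇒adj {x} {y} xy =
    dec-true (Adj? _ _) (subst₂ Adj (sym (vertex-index x)) (sym (vertex-index y)) xy)

  cliqueNeighbours : V → List (Fin N)
  cliqueNeighbours (b , r) = map (λ s → index (b , punchIn r s)) (allFin (suc d))

  minDegree-index : ∀ x → suc d ≤ deg (adj G) (index x)
  minDegree-index x@(b , r) = subst (_≤ deg (adj G) (index x)) length-cliqueNeighbours
    (length≤deg (adj G) (index x) unique adjacent)
    where
    length-cliqueNeighbours : length (cliqueNeighbours x) ≡ suc d
    length-cliqueNeighbours =
      trans (length-map _ (allFin (suc d))) (length-tabulate {n = suc d} (λ s → s))
    unique : Unique (cliqueNeighbours x)
    unique = map⁺ (λ eq → punchIn-injective r _ _ (cong proj₂ (index-injective eq))) (allFin⁺ (suc d))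
    adjacent : ∀ {w} → w ∈ cliqueNeighbours x → adj G (index x) w ≡ true
    adjacent w∈ with ∈-map⁻ _ w∈
    ... | s , _ , refl = Adj⇒adj (inj₁ (clique b λ r≡ → punchInᵢ≢i r s (sym r≡)))

  minDegree : MinDegreeAtLeast G d
  minDegree v =
    subst (λ u → d ≤ deg (adj G) u) (index-vertex v) (≤-trans (n≤1+n d) (minDegree-index (vertex v)))

  within : ∀ b r r′ → Star Adj (b , r) (b , r′)
  within b r r′ with r ≟ᶠ r′
  ... | yes refl = ε
  ... | no r≢r′ = inj₁ (clique b r≢r′) ◅ ε

  core⇝hub : ∀ t j → Star Adj (core t , j) (hub , 0F)
  core⇝hub t j = within _ j 0F ◅◅ inj₁ (bridge 0F ≤-refl) ◅ within _ 0F 1F ◅◅ inj₁ (link t) ◅ ε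

  ⇝hub : ∀ v → Star Adj v (hub , 0F)
  ⇝hub (hub , r) = within hub r 0F
  ⇝hub (core t , j) = core⇝hub t j
  ⇝hub (pend t j p , r) with p ≤? t
  ... | yes p≤t = within _ r 0F ◅◅ inj₂ (bridge j p≤t) ◅ core⇝hub t j
  ... | no p≰t = within _ r 0F ◅◅ inj₁ (tether (≰⇒> p≰t)) ◅ ε

  connected : Connected (adj G)
  connected u v = star⇒walk (subst₂ (Star _) (index-vertex u) (index-vertex v)
    (gmap index Adj⇒adj (⇝hub (vertex u) ◅◅ reverse swap (⇝hub (vertex v)))))

  IsCore : Fin k → V → Set
  IsCore t v = proj₁ v ≡ core t

  _≟ᴾ_ : DecidableEquality (Fin m × Fin k)
  _≟ᴾ_ = ×.≡-dec _≟ᶠ_ _≟ᶠ_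

  data CoreSide (t : Fin k) : V → Set where
    centre  : ∀ r → CoreSide t (core t , r)
    pendant : ∀ {j p} r → p ≤ᶠ t → (j , p) ≢ (0F , t) → CoreSide t (pend t j p , r)

  CoreSide? : ∀ t → Decidable (CoreSide t)
  CoreSide? t (hub , _) = no λ ()
  CoreSide? t (core t′ , r) = map′ (λ { refl → centre r }) (λ { (centre _) → refl }) (t′ ≟ᶠ t)
  CoreSide? t (pend t′ j p , r) =
    map′ (λ { (refl , p≤t , not-link) → pendant r p≤t not-link })
         (λ { (pendant _ p≤t not-link) → refl , p≤t , not-link })
         (t′ ≟ᶠ t ×-dec p ≤? t ×-dec ¬? ((j , p) ≟ᴾ (0F , t)))

  data Tuft (t : Fin k) (j : Fin m) : V → Set where
    centre  : Tuft t j (core t , j)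
    pendant : ∀ {p} r → p ≤ᶠ t → Tuft t j (pend t j p , r)

  Tuft? : ∀ t j → Decidable (Tuft t j)
  Tuft? t j (hub , _) = no λ ()
  Tuft? t j (core t′ , r) =
    map′ (λ { (refl , refl) → centre }) (λ { centre → refl , refl }) (t′ ≟ᶠ t ×-dec r ≟ᶠ j)
  Tuft? t j (pend t′ j′ p , r) =
    map′ (λ { (refl , refl , p≤t) → pendant r p≤t }) (λ { (pendant _ p≤t) → refl , refl , p≤t })
         (t′ ≟ᶠ t ×-dec j′ ≟ᶠ j ×-dec p ≤? t)

  leaving-pendant : ∀ {t j p u v} → p ≤ᶠ t → (j , p) ≢ (0F , t) → Adj u v →
    proj₁ u ≡ pend t j p → proj₁ v ≢ pend t j p → u ≡ (pend t j p , 0F) × v ≡ (core t , j)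
  leaving-pendant _   _        (inj₁ (clique _ _)) refl outside = contradiction refl outside
  leaving-pendant p≤t _        (inj₁ (tether t<p)) refl _       = contradiction p≤t (<⇒≱ t<p)
  leaving-pendant _   not-link (inj₁ (link _))     refl _       = contradiction refl not-link
  leaving-pendant _   _        (inj₂ (clique _ _)) refl outside = contradiction refl outside
  leaving-pendant _   _        (inj₂ (bridge _ _)) refl _       = refl , refl

  leaving-core-side : ∀ {t u v} → Adj u v → CoreSide t u → ¬ CoreSide t v →
    u ≡ (core t , 0F) × v ≡ (pend t 0F t , 0F)
  leaving-core-side (inj₁ (clique _ _)) (centre _) outside = contradiction (centre _) outside
  leaving-core-side (inj₁ (clique _ _)) (pendant _ p≤t not-link) outside =
    contradiction (pendant _ p≤t not-link) outside
  leaving-core-side {t} (inj₁ (bridge {p = p} j p≤t)) (centre _) outside with (j , p) ≟ᴾ (0F , t)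
  ... | yes refl = refl , refl
  ... | no not-link = contradiction (pendant 0F p≤t not-link) outside
  leaving-core-side (inj₁ (tether t<p)) (pendant _ p≤t _) _ = contradiction p≤t (<⇒≱ t<p)
  leaving-core-side (inj₁ (link _)) (pendant _ _ not-link) _ = contradiction refl not-link
  leaving-core-side (inj₂ (clique _ _)) (centre _) outside = contradiction (centre _) outside
  leaving-core-side (inj₂ (clique _ _)) (pendant _ p≤t not-link) outside =
    contradiction (pendant _ p≤t not-link) outside
  leaving-core-side (inj₂ (bridge _ _)) (pendant _ _ _) outside = contradiction (centre _) outside

  leaving-tuft : ∀ {t j u v} → j ≢ 0F → Adj u v → Tuft t j u → ¬ Tuft t j v →
    IsCore t u × IsCore t v
  leaving-tuft _   (inj₁ (clique _ _)) centre          _       = refl , refl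
  leaving-tuft _   (inj₁ (clique _ _)) (pendant _ p≤t) outside = contradiction (pendant _ p≤t) outside
  leaving-tuft _   (inj₁ (bridge _ p≤t)) centre        outside = contradiction (pendant 0F p≤t) outside
  leaving-tuft _   (inj₁ (tether t<p)) (pendant _ p≤t) _       = contradiction p≤t (<⇒≱ t<p)
  leaving-tuft j≢0 (inj₁ (link _))     (pendant _ _)   _       = contradiction refl j≢0
  leaving-tuft _   (inj₂ (clique _ _)) centre          _       = refl , refl
  leaving-tuft _   (inj₂ (clique _ _)) (pendant _ p≤t) outside = contradiction (pendant _ p≤t) outside
  leaving-tuft _   (inj₂ (bridge _ _)) (pendant _ _)   outside = contradiction centre outside

  core-neighbour : ∀ {t j v} → Adj (core t , j) v →
    IsCore t v ⊎ ∃[ p ] (p ≤ᶠ t × v ≡ (pend t j p , 0F))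
  core-neighbour (inj₁ (clique _ _))   = inj₁ refl
  core-neighbour (inj₁ (bridge _ p≤t)) = inj₂ (_ , p≤t , refl)
  core-neighbour (inj₂ (clique _ _))   = inj₁ refl

  pendantIndices : Fin k → List (Fin k)
  pendantIndices t = map (λ q → inject≤ q (toℕ<n t)) (allFin (suc (toℕ t)))

  length-pendantIndices : ∀ t → length (pendantIndices t) ≡ suc (toℕ t)
  length-pendantIndices t =
    trans (length-map (λ q → inject≤ q (toℕ<n t)) (allFin (suc (toℕ t))))
          (length-tabulate {n = suc (toℕ t)} (λ q → q))

  pendantIndices-unique : ∀ t → Unique (pendantIndices t)
  pendantIndices-unique t = map⁺ (inject≤-injective _ _ _ _) (allFin⁺ _)

  ∈-pendantIndices⁺ : ∀ {t p} → p ≤ᶠ t → p ∈ pendantIndices t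
  ∈-pendantIndices⁺ {t} {p} p≤t =
    subst (_∈ pendantIndices t) inject≤-fromℕ< (∈-map⁺ _ (∈-allFin (fromℕ< (s≤s p≤t))))
    where
    inject≤-fromℕ< : inject≤ (fromℕ< (s≤s p≤t)) (toℕ<n t) ≡ p
    inject≤-fromℕ< = toℕ-injective (trans (toℕ-inject≤ _ (toℕ<n t)) (toℕ-fromℕ< (s≤s p≤t)))

  ∈-pendantIndices⁻ : ∀ {t p} → p ∈ pendantIndices t → p ≤ᶠ t
  ∈-pendantIndices⁻ {t} p∈ with ∈-map⁻ _ p∈
  ... | q , _ , refl = subst (_≤ toℕ t) (sym (toℕ-inject≤ q (toℕ<n t))) (s≤s⁻¹ (toℕ<n q))

  module _ (T : SpanningTree G) where

    tree-crosses : ∀ {S : V → Set} → Decidable S → ∀ a b → S a → ¬ S b →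
      ∃[ u ] ∃[ v ] (tadj T u v ≡ true × Adj (vertex u) (vertex v) × S (vertex u) × ¬ S (vertex v))
    tree-crosses {S} S? a b Sa ¬Sb
      with connected-crosses (tconn T) (λ w → S? (vertex w))
             (subst S (sym (vertex-index a)) Sa) (λ Sb′ → ¬Sb (subst S (vertex-index b) Sb′))
    ... | u , v , uv , Su , ¬Sv = u , v , uv , adj⇒Adj (sub T u v uv) , Su , ¬Sv

    unique-exit∈tree : ∀ {S : V → Set} → Decidable S → ∀ a b {x y} → S a → ¬ S b →
      (∀ {u v} → Adj u v → S u → ¬ S v → u ≡ x × v ≡ y) → tadj T (index x) (index y) ≡ true
    unique-exit∈tree S? a b Sa ¬Sb exit with tree-crosses S? a b Sa ¬Sb
    ... | u , v , uv , Auv , Su , ¬Sv with exit Auv Su ¬Sv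
    ... | refl , refl =
      subst₂ (λ u v → tadj T u v ≡ true) (sym (index-vertex u)) (sym (index-vertex v)) uv

    bridge∈tree : ∀ {t j p} → p ≤ᶠ t → tadj T (index (core t , j)) (index (pend t j p , 0F)) ≡ true
    bridge∈tree {t} {j} {p} p≤t with (j , p) ≟ᴾ (0F , t)
    ... | yes refl =
      unique-exit∈tree (CoreSide? t) (core t , 0F) (pend t 0F t , 1F)
        (centre 0F) (λ { (pendant _ _ not-link) → not-link refl }) leaving-core-side
    ... | no not-link = trans (tsym T _ _)
      (unique-exit∈tree (λ v → proj₁ v ≟ᵇ pend t j p) (pend t j p , 0F) (core t , j)
        refl (λ ()) (leaving-pendant p≤t not-link))

    core-leaf-degree : ∀ {t x y} → InducedLeaf (tadj T) (λ w → IsCore t (vertex w)) x y →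
      deg (tadj T) x ≡ 2 + toℕ t
    core-leaf-degree {t} {x} {y} (x-core , y-core , xy , only-y) =
      trans (deg≡length (tadj T) x unique adjacent complete)
            (cong suc (trans (length-map base (pendantIndices t)) (length-pendantIndices t)))
      where
      j : Fin m
      j = proj₂ (vertex x)
      vertex-x : vertex x ≡ (core t , j)
      vertex-x = cong (_, j) x-core
      x≡ : x ≡ index (core t , j)
      x≡ = trans (sym (index-vertex x)) (cong index vertex-x)
      base : Fin k → Fin N
      base p = index (pend t j p , 0F)
      base-injective : ∀ {p q} → base p ≡ base q → p ≡ q
      base-injective eq with index-injective eq
      ... | refl = refl
      y∉bases : ∀ {w} → w ∈ map base (pendantIndices t) → y ≢ w
      y∉bases w∈ refl with ∈-map⁻ base w∈
      ... | p , _ , refl with trans (sym y-core) (cong proj₁ (vertex-index (pend t j p , 0F)))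
      ... | ()
      unique : Unique (y ∷ map base (pendantIndices t))
      unique = All.tabulate y∉bases ∷ map⁺ base-injective (pendantIndices-unique t)
      adjacent : ∀ {w} → w ∈ y ∷ map base (pendantIndices t) → tadj T x w ≡ true
      adjacent (here refl) = xy
      adjacent (there w∈) with ∈-map⁻ base w∈
      ... | p , p∈ , refl =
        subst (λ z → tadj T z (base p) ≡ true) (sym x≡) (bridge∈tree (∈-pendantIndices⁻ p∈))
      complete : ∀ {w} → tadj T x w ≡ true → w ∈ y ∷ map base (pendantIndices t)
      complete {w} xw
        with core-neighbour (subst (λ z → Adj z (vertex w)) vertex-x (adj⇒Adj (sub T x w xw)))
      ... | inj₁ w-core = here (only-y w w-core xw)
      ... | inj₂ (p , p≤t , vertex-w) =
        there (subst (_∈ map base (pendantIndices t)) (trans (cong index (sym vertex-w)) (index-vertex w))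
                 (∈-map⁺ base (∈-pendantIndices⁺ p≤t)))

    core-degree : ∀ t → ∃[ x ] deg (tadj T) x ≡ 2 + toℕ t
    core-degree t with tree-crosses (Tuft? t 1F) (core t , 1F) (core t , 0F) centre (λ ())
    ... | u , v , uv , Auv , Su , ¬Sv with leaving-tuft (λ ()) Auv Su ¬Sv
    ... | u-core , v-core
      with tree-induced-leaf T (λ w → proj₁ (vertex w) ≟ᵇ core t) u-core v-core uv
    ... | x , y , leaf = x , core-leaf-degree leaf

    leaf-degree : ∃[ x ] deg (tadj T) x ≡ 1
    leaf-degree with tree-crosses (λ v → (hub , 0F) ≟ⱽ v) (hub , 0F) (hub , 1F) refl (λ ())
    ... | u , v , uv , _ with tree-induced-leaf T {λ _ → ⊤} (λ _ → yes tt) tt tt uv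
    ... | x , y , _ , _ , xy , only-y =
      x , deg≡length (tadj T) x ([] ∷ []) (λ { (here refl) → xy }) (λ xw → here (only-y _ tt xw))

theorem2p2 : (k d : ℕ) → ∃[ G ] (MinDegreeAtLeast G d × Connected (adj G) ×
    ((T : SpanningTree G) → (i : ℕ) → 1 ≤ i → i ≤ k → ∃[ v ] (deg (tadj T) v ≡ i)))
theorem2p2 k d = G , minDegree , connected , degrees
  where
  open Construction k d
  degrees : (T : SpanningTree G) → (i : ℕ) → 1 ≤ i → i ≤ k → ∃[ v ] (deg (tadj T) v ≡ i)
  degrees T (suc zero) _ _ = leaf-degree T
  degrees T (suc (suc i)) _ 2+i≤k =
    let i<k = ≤-trans (n≤1+n (suc i)) 2+i≤k
        x , deg≡ = core-degree T (fromℕ< i<k)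
    in x , trans deg≡ (cong (2 +_) (toℕ-fromℕ< i<k))
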